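{- There exists a family $\{T_n: n\ge 3,\ n \text{ odd}\}$ of finite reflexive tournaments such that no two distinct members $T_m,T_n$ ($m\ne n$) are siblings.
   Context: A reflexive tournament is $(T,\to)$ with $\to\subseteq T^2$ reflexive and such that for all $x\ne y$ exactly one of $x\to y$, $y\to x$ holds. A homomorphism $f:(S,\to)\to(T,\to)$ is a map with $x\to y\Rightarrow f(x)\to f(y)$. A reflexive tournament $T$ is an inflation of $S$ if there is a surjective homomorphism $T\to S$. Two reflexive tournaments $S_1,S_2$ are siblings if some reflexive tournament is an inflation of both. -}

module Defs where

open import Data.Nat using (ℕ; _+_; _*_; _≤_)
open import Data.Fin using (Fin)
open import Data.Product using (Σ; _×_; ∃; ∃-syntax; _,_)
open import Data.Sum using (_⊎_)
open import Function using (Surjective)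
open import Relation.Binary.PropositionalEquality using (_≡_; _≢_)
open import Relation.Nullary using (¬_)

record ReflexiveTournament : Set₁ where
  field
    Carrier : Set
    _⇒_     : Carrier → Carrier → Set
    reflexive : ∀ x → x ⇒ x
    tournament : ∀ x y → x ≢ y → (x ⇒ y × ¬ (y ⇒ x)) ⊎ (y ⇒ x × ¬ (x ⇒ y))

open ReflexiveTournament public

IsHom : (S T : ReflexiveTournament) → (Carrier S → Carrier T) → Set
IsHom S T f = ∀ x y → _⇒_ S x y → _⇒_ T (f x) (f y)

InflationOf : ReflexiveTournament → ReflexiveTournament → Set
InflationOf T S = Σ (Carrier T → Carrier S) λ f →
  IsHom T S f × Surjective _≡_ _≡_ f

Siblings : ReflexiveTournament → ReflexiveTournament → Set₁
Siblings S₁ S₂ = Σ ReflexiveTournament λ T → InflationOf T S₁ × InflationOf T S₂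

IsFinite : ReflexiveTournament → Set
IsFinite T = Σ ℕ λ k → Σ (Carrier T → Fin k) λ f → Σ (Fin k → Carrier T) λ g →
  (∀ x → g (f x) ≡ x) × (∀ i → f (g i) ≡ i)

Odd : ℕ → Set
Odd n = ∃[ k ] n ≡ 1 + 2 * k

-- Let T inflate S₁ and S₂ via f and g. For every b, the f-image of the fibre
-- g⁻¹ b is a module of S₁. If S₁ is prime and this image has two points, it is
-- all of S₁; choosing y with g y not dominating b, every point of the fibre
-- dominates y, so f y is a sink of S₁. Hence, when both tournaments are prime
-- and sink-free, f and g have the same fibres and |S₁| = |S₂|. The tournament
-- on 0, …, n−1 with arcs i → i+1 and all arcs of length at least 2 pointing
-- backwards is sink-free for n ≥ 3 and prime for n ≠ 4.
module Submission where

open import Defs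
open import Data.Nat using (ℕ; _≤_)
open import Data.Product using (Σ; _×_)
open import Relation.Binary.PropositionalEquality using (_≢_)
open import Relation.Nullary using (¬_)

open import Data.Nat using (zero; suc; _+_; _*_; _<_; _≤′_; ≤′-refl; ≤′-step; z≤n; s≤s; s≤s⁻¹; _%_)
open import Data.Nat.Properties
open import Data.Nat.DivMod using ([m+kn]%n≡m%n)
open import Data.Fin using (Fin; toℕ; fromℕ<)
open import Data.Fin.Properties using (toℕ-injective; toℕ<n; toℕ-fromℕ<; injective⇒≤)
import Data.Fin.Properties as Fin
open import Data.Product using (∃-syntax; _,_; proj₁; proj₂)
open import Data.Sum using (_⊎_; inj₁; inj₂; swap)
open import Effect.Monad using (RawMonad)
open import Function using (id; Surjective)
open import Level using (0ℓ)
open import Relation.Binary using (tri<; tri≈; tri>)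
open import Relation.Binary.PropositionalEquality
  using (_≡_; refl; sym; trans; cong; subst; module ≡-Reasoning)
open import Relation.Nullary using (yes; no; contradiction)
open import Relation.Nullary.Decidable using (decidable-stable)
open import Relation.Nullary.Negation using (¬¬-map; ¬¬-Monad)

open RawMonad (¬¬-Monad {a = 0ℓ})

_∋_⇒_ : (S : ReflexiveTournament) → Carrier S → Carrier S → Set
S ∋ x ⇒ y = _⇒_ S x y

⇒-asym : (S : ReflexiveTournament) {x y : Carrier S} →
         x ≢ y → S ∋ x ⇒ y → ¬ S ∋ y ⇒ x
⇒-asym S {x} {y} x≢y x⇒y y⇒x with tournament S x y x≢y
... | inj₁ (_ , y⇏x) = y⇏x y⇒x
... | inj₂ (_ , x⇏y) = x⇏y x⇒y

⇒-connex : (S : ReflexiveTournament) {x y : Carrier S} →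
           x ≢ y → ¬ S ∋ y ⇒ x → S ∋ x ⇒ y
⇒-connex S {x} {y} x≢y y⇏x with tournament S x y x≢y
... | inj₁ (x⇒y , _) = x⇒y
... | inj₂ (y⇒x , _) = contradiction y⇒x y⇏x

-- In a tournament this says: every vertex outside M dominates all of M or is
-- dominated by all of M.
IsModule : (S : ReflexiveTournament) → (Carrier S → Set) → Set
IsModule S M = ∀ {s t u} → ¬ M s → M t → M u → S ∋ s ⇒ t → S ∋ s ⇒ u

-- Membership is only double-negated: a module is an arbitrary, undecidable predicate.
IsPrime : ReflexiveTournament → Set₁
IsPrime S = ∀ {M} → IsModule S M → ∀ {t u} → M t → M u → t ≢ u → ∀ s → ¬ ¬ M s

HasNoSink : ReflexiveTournament → Set
HasNoSink S = ∀ v → ∃[ s ] ¬ S ∋ s ⇒ v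

FibreImage : {A B C : Set} → (A → B) → (A → C) → C → B → Set
FibreImage f g c b = ∃[ z ] g z ≡ c × f z ≡ b

module _ {T S₁ S₂ : ReflexiveTournament}
         {f : Carrier T → Carrier S₁} (f-hom : IsHom T S₁ f)
         {g : Carrier T → Carrier S₂} (g-hom : IsHom T S₂ g) where

  fibreImage-⇒ : ∀ {b y s} → ¬ S₂ ∋ g y ⇒ b → FibreImage f g b s → S₁ ∋ s ⇒ f y
  fibreImage-⇒ {b} {y} gy⇏b (z , gz≡b , refl) = f-hom z y (⇒-connex T z≢y y⇏z)
    where
    z≢y : z ≢ y
    z≢y refl = gy⇏b (subst (S₂ ∋ g z ⇒_) gz≡b (reflexive S₂ (g z)))
    y⇏z : ¬ T ∋ y ⇒ z
    y⇏z y⇒z = gy⇏b (subst (S₂ ∋ g y ⇒_) gz≡b (g-hom y z y⇒z))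

  -- A preimage w of s lies outside the fibre, so s → t forces w → z₁, hence
  -- g w → b strictly, which in turn forces w → z₂.
  fibreImage-isModule : Surjective _≡_ _≡_ f → ∀ b → IsModule S₁ (FibreImage f g b)
  fibreImage-isModule f-surj b {s} ¬Ms (z₁ , gz₁≡b , refl) (z₂ , gz₂≡b , refl) s⇒fz₁ =
    subst (λ a → S₁ ∋ a ⇒ f z₂) fw≡s (f-hom w z₂ w⇒z₂)
    where
    w = proj₁ (f-surj s)
    fw≡s : f w ≡ s
    fw≡s = proj₂ (f-surj s) refl
    gw≢b : g w ≢ b
    gw≢b gw≡b = ¬Ms (w , gw≡b , fw≡s)
    w≢z : ∀ {z} → g z ≡ b → w ≢ z
    w≢z gz≡b refl = gw≢b gz≡b
    w⇒z₁ : T ∋ w ⇒ z₁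
    w⇒z₁ = ⇒-connex T (w≢z gz₁≡b) λ z₁⇒w →
      ⇒-asym S₁ (λ s≡fz₁ → ¬Ms (z₁ , gz₁≡b , sym s≡fz₁)) s⇒fz₁
        (subst (S₁ ∋ f z₁ ⇒_) fw≡s (f-hom z₁ w z₁⇒w))
    gw⇒b : S₂ ∋ g w ⇒ b
    gw⇒b = subst (S₂ ∋ g w ⇒_) gz₁≡b (g-hom w z₁ w⇒z₁)
    w⇒z₂ : T ∋ w ⇒ z₂
    w⇒z₂ = ⇒-connex T (w≢z gz₂≡b) λ z₂⇒w →
      ⇒-asym S₂ gw≢b gw⇒b (subst (λ c → S₂ ∋ c ⇒ g w) gz₂≡b (g-hom z₂ w z₂⇒w))

  kernel-⊆ : IsPrime S₁ → HasNoSink S₁ → HasNoSink S₂ →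
             Surjective _≡_ _≡_ f → Surjective _≡_ _≡_ g →
             ∀ {x y} → g x ≡ g y → ¬ f x ≢ f y
  kernel-⊆ S₁-prime S₁-noSink S₂-noSink f-surj g-surj {x} {y} gx≡gy fx≢fy =
    S₁-prime (fibreImage-isModule f-surj (g x)) (x , refl , refl) (y , sym gx≡gy , refl)
      fx≢fy s λ s∈image → s⇏fy′ (fibreImage-⇒ gy′⇏gx s∈image)
    where
    b = proj₁ (S₂-noSink (g x))
    y′ = proj₁ (g-surj b)
    gy′⇏gx : ¬ S₂ ∋ g y′ ⇒ g x
    gy′⇏gx = subst (λ c → ¬ S₂ ∋ c ⇒ g x) (sym (proj₂ (g-surj b) refl))
                   (proj₂ (S₂-noSink (g x)))
    s = proj₁ (S₁-noSink (f y′))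
    s⇏fy′ : ¬ S₁ ∋ s ⇒ f y′
    s⇏fy′ = proj₂ (S₁-noSink (f y′))

inflations-size-≤ : {T S S′ : ReflexiveTournament} →
                    IsPrime S → HasNoSink S → HasNoSink S′ →
                    InflationOf T S → InflationOf T S′ →
                    (F : IsFinite S) (F′ : IsFinite S′) → proj₁ F ≤ proj₁ F′
inflations-size-≤ {T} {S} {S′} S-prime S-noSink S′-noSink
  (f , f-hom , f-surj) (g , g-hom , g-surj)
  (m , toFin , fromFin , _ , to∘from) (m′ , toFin′ , fromFin′ , from∘to′ , _) =
  injective⇒≤ h-injective
  where
  lift : Carrier S → Carrier T
  lift s = proj₁ (f-surj s)
  f∘lift : ∀ s → f (lift s) ≡ s
  f∘lift s = proj₂ (f-surj s) refl
  h : Fin m → Fin m′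
  h i = toFin′ (g (lift (fromFin i)))
  h-injective : ∀ {i j} → h i ≡ h j → i ≡ j
  h-injective {i} {j} hi≡hj = decidable-stable (i Fin.≟ j) (¬¬-map fromFin-cancel
    (¬¬-map (λ e → trans (sym (f∘lift _)) (trans e (f∘lift _)))
      (kernel-⊆ {T} {S} {S′} f-hom g-hom S-prime S-noSink S′-noSink f-surj g-surj
        (trans (sym (from∘to′ _)) (trans (cong fromFin′ hi≡hj) (from∘to′ _))))))
    where
    fromFin-cancel : fromFin i ≡ fromFin j → i ≡ j
    fromFin-cancel e = trans (sym (to∘from i)) (trans (cong toFin e) (to∘from j))

siblings⇒sameSize : {S₁ S₂ : ReflexiveTournament} →
                    IsPrime S₁ → HasNoSink S₁ → IsPrime S₂ → HasNoSink S₂ →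
                    (F₁ : IsFinite S₁) (F₂ : IsFinite S₂) →
                    Siblings S₁ S₂ → proj₁ F₁ ≡ proj₁ F₂
siblings⇒sameSize {S₁} {S₂} prime₁ noSink₁ prime₂ noSink₂ F₁ F₂ (T , inf₁ , inf₂) = ≤-antisym
  (inflations-size-≤ {T} {S₁} {S₂} prime₁ noSink₁ noSink₂ inf₁ inf₂ F₁ F₂)
  (inflations-size-≤ {T} {S₂} {S₁} prime₂ noSink₂ noSink₁ inf₂ inf₁ F₂ F₁)

data _↝_ : ℕ → ℕ → Set where
  ↝-refl : ∀ {a} → a ↝ a
  ↝-next : ∀ {a} → a ↝ suc a
  ↝-back : ∀ {a b} → suc (suc b) ≤ a → a ↝ b

¬↝-forward : ∀ {a b} → a < b → suc a ≢ b → ¬ a ↝ b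
¬↝-forward a<b _     ↝-refl         = <-irrefl refl a<b
¬↝-forward _   a+1≢b ↝-next         = a+1≢b refl
¬↝-forward a<b _     (↝-back b+2≤a) = <⇒≱ a<b (≤-trans (n≤1+n _) (≤-trans (n≤1+n _) b+2≤a))

¬suc↝ : ∀ {a} → ¬ suc a ↝ a
¬suc↝ (↝-back a+2≤a+1) = 1+n≰n (s≤s⁻¹ a+2≤a+1)

↝-tournament-< : ∀ {a b} → a < b → (a ↝ b × ¬ b ↝ a) ⊎ (b ↝ a × ¬ a ↝ b)
↝-tournament-< {a} {b} a<b with suc a ≟ b
... | yes refl = inj₁ (↝-next , ¬suc↝)
... | no a+1≢b = inj₂ (↝-back (≤∧≢⇒< a<b a+1≢b) , ¬↝-forward a<b a+1≢b)

↝-tournament : ∀ {a b} → a ≢ b → (a ↝ b × ¬ b ↝ a) ⊎ (b ↝ a × ¬ a ↝ b)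
↝-tournament {a} {b} a≢b with <-cmp a b
... | tri< a<b _ _ = ↝-tournament-< a<b
... | tri≈ _ a≡b _ = contradiction a≡b a≢b
... | tri> _ _ b<a = swap (↝-tournament-< b<a)

PathTournament : ℕ → ReflexiveTournament
PathTournament n = record
  { Carrier    = Fin n
  ; _⇒_        = λ i j → toℕ i ↝ toℕ j
  ; reflexive  = λ _ → ↝-refl
  ; tournament = λ i j i≢j → ↝-tournament (λ e → i≢j (toℕ-injective e))
  }

PathTournament-finite : ∀ n → IsFinite (PathTournament n)
PathTournament-finite n = n , id , id , (λ _ → refl) , (λ _ → refl)

↝-noSink : ∀ {n a} → 3 ≤ n → a < n → ∃[ s ] s < n × ¬ s ↝ a
↝-noSink {n} {a} 3≤n a<n with suc a <? n
... | yes a+1<n = suc a , a+1<n , ¬suc↝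
... | no a+1≮n  = 0 , ≤-trans (s≤s z≤n) 3≤n , ¬↝-forward (≤-trans (s≤s z≤n) 2≤a) (<⇒≢ 2≤a)
  where
  2≤a : 2 ≤ a
  2≤a = s≤s⁻¹ (≤-trans 3≤n (≮⇒≥ a+1≮n))

PathTournament-noSink : ∀ {n} → 3 ≤ n → HasNoSink (PathTournament n)
PathTournament-noSink 3≤n v with s , s<n , s⇏v ← ↝-noSink 3≤n (toℕ<n v) =
  fromℕ< s<n , subst (λ a → ¬ a ↝ toℕ v) (sym (toℕ-fromℕ< s<n)) s⇏v

module ↝-Prime {n : ℕ} (n≢4 : n ≢ 4) {M : ℕ → Set} (M⊆n : ∀ {k} → M k → k < n)
  (M-module : ∀ {s t u} → s < n → ¬ M s → M t → M u → s ↝ t → s ↝ u) where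

  absorb : ∀ {s t u} → s < n → M t → M u → s ↝ t → ¬ s ↝ u → ¬ ¬ M s
  absorb s<n Mt Mu s↝t s↝̸u ¬Ms = s↝̸u (M-module s<n ¬Ms Mt Mu s↝t)

  fill-gap : ∀ {t} → M t → M (suc (suc t)) → ¬ ¬ M (suc t)
  fill-gap Mt Mt+2 = absorb (<-trans (n<1+n _) (M⊆n Mt+2)) Mt+2 Mt ↝-next ¬suc↝

  Pair : ℕ → Set
  Pair k = M k × M (suc k)

  pair-up : ∀ {k} → Pair k → suc (suc k) < n → ¬ ¬ Pair (suc k)
  pair-up (Mk , Mk+1) k+2<n = do
    Mk+2 ← absorb k+2<n Mk Mk+1 (↝-back ≤-refl) ¬suc↝
    pure (Mk+1 , Mk+2)

  pair-down : ∀ {k} → Pair (suc k) → ¬ ¬ Pair k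
  pair-down (Mk+1 , Mk+2) = do
    Mk ← absorb (<-trans (n<1+n _) (M⊆n Mk+1)) Mk+1 Mk+2 ↝-next
           (¬↝-forward (≤-trans (n<1+n _) (n≤1+n _)) (<⇒≢ (n<1+n _)))
    pure (Mk , Mk+1)

  pairs-above : ∀ {i j} → Pair i → i ≤′ j → suc j < n → ¬ ¬ Pair j
  pairs-above p ≤′-refl        _     = pure p
  pairs-above p (≤′-step i≤′j) j+1<n = do
    q ← pairs-above p i≤′j (<-trans (n<1+n _) j+1<n)
    pair-up q j+1<n

  pairs-below : ∀ {i j} → Pair i → j ≤′ i → ¬ ¬ Pair j
  pairs-below p ≤′-refl        = pure p
  pairs-below p (≤′-step j≤′i) = do
    q ← pair-down p
    pairs-below q j≤′i

  pair⇒everywhere : ∀ {i k} → Pair i → k < n → ¬ ¬ M k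
  pair⇒everywhere {i} {zero}  p _   = proj₁ <$> pairs-below p (≤⇒≤′ z≤n)
  pair⇒everywhere {i} {suc k} p k<n with suc k ≤? i
  ... | yes k+1≤i = proj₁ <$> pairs-below p (≤⇒≤′ k+1≤i)
  ... | no  k+1≰i = proj₂ <$> pairs-above p (≤⇒≤′ (m<1+n⇒m≤n (≰⇒> k+1≰i))) k<n

  -- For t = 0 and u = n − 1 the absorbing vertex is 2, which needs u ≢ 3: this
  -- is where n ≢ 4 enters.
  pair-beyond : ∀ {t u} → suc (suc (suc t)) ≤ u → M t → M u → ¬ ¬ (∃[ k ] Pair k)
  pair-beyond {suc j} {u} t+3≤u Mt Mu = do
    Mj ← absorb (<-trans (n<1+n _) (M⊆n Mt)) Mt Mu ↝-next
           (¬↝-forward (<-trans (n<1+n j) t<u) (<⇒≢ t<u))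
    pure (j , Mj , Mt)
    where
    t<u : suc j < u
    t<u = ≤-trans (n≤1+n _) (≤-trans (n≤1+n _) t+3≤u)
  pair-beyond {zero} {u} 3≤u M0 Mu with suc u <? n
  ... | yes u+1<n = do
    Mu+1 ← absorb u+1<n M0 Mu (↝-back (s≤s (≤-trans (s≤s z≤n) 3≤u))) ¬suc↝
    pure (u , Mu , Mu+1)
  ... | no u+1≮n = do
    M2 ← absorb (≤-trans 3≤u (<⇒≤ (M⊆n Mu))) M0 Mu (↝-back ≤-refl) (¬↝-forward 3≤u 3≢u)
    M1 ← fill-gap M0 M2
    pure (0 , M0 , M1)
    where
    3≢u : 3 ≢ u
    3≢u 3≡u = n≢4 (trans (≤-antisym (≮⇒≥ u+1≮n) (M⊆n Mu)) (cong suc (sym 3≡u)))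

  pair-between : ∀ {t u} → t < u → M t → M u → ¬ ¬ (∃[ k ] Pair k)
  pair-between {t} {u} t<u Mt Mu with suc t ≟ u | suc (suc t) ≟ u
  ... | yes refl | _        = pure (t , Mt , Mu)
  ... | no _     | yes refl = do
    Mt+1 ← fill-gap Mt Mu
    pure (t , Mt , Mt+1)
  ... | no t+1≢u | no t+2≢u = pair-beyond (≤∧≢⇒< (≤∧≢⇒< t<u t+1≢u) t+2≢u) Mt Mu

  everywhere : ∀ {t u s} → t ≢ u → M t → M u → s < n → ¬ ¬ M s
  everywhere {t} {u} t≢u Mt Mu s<n with <-cmp t u
  ... | tri< t<u _ _ = pair-between t<u Mt Mu >>= λ (_ , p) → pair⇒everywhere p s<n
  ... | tri≈ _ t≡u _ = contradiction t≡u t≢u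
  ... | tri> _ _ u<t = pair-between u<t Mu Mt >>= λ (_ , p) → pair⇒everywhere p s<n

PathTournament-prime : ∀ {n} → n ≢ 4 → IsPrime (PathTournament n)
PathTournament-prime {n} n≢4 {M} M-module {t} {u} Mt Mu t≢u s =
  ¬¬-map (λ (i , toℕi≡toℕs , Mi) → subst M (toℕ-injective toℕi≡toℕs) Mi)
    (↝-Prime.everywhere n≢4 M′⊆n M′-module (λ e → t≢u (toℕ-injective e))
      (t , refl , Mt) (u , refl , Mu) (toℕ<n s))
  where
  M′ : ℕ → Set
  M′ k = ∃[ i ] toℕ i ≡ k × M i
  M′⊆n : ∀ {k} → M′ k → k < n
  M′⊆n (i , refl , _) = toℕ<n i
  M′-module : ∀ {a b c} → a < n → ¬ M′ a → M′ b → M′ c → a ↝ b → a ↝ c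
  M′-module a<n ¬M′a (i , refl , Mi) (j , refl , Mj) a↝i =
    subst (_↝ toℕ j) toℕa′≡a
      (M-module (λ Ma′ → ¬M′a (a′ , toℕa′≡a , Ma′)) Mi Mj (subst (_↝ toℕ i) (sym toℕa′≡a) a↝i))
    where
    a′ = fromℕ< a<n
    toℕa′≡a = toℕ-fromℕ< a<n

odd⇒%2≡1 : ∀ {n} → Odd n → n % 2 ≡ 1
odd⇒%2≡1 (k , refl) = begin
  (1 + 2 * k) % 2 ≡⟨ cong (λ m → (1 + m) % 2) (*-comm 2 k) ⟩
  (1 + k * 2) % 2 ≡⟨ [m+kn]%n≡m%n 1 k 2 ⟩
  1               ∎
  where open ≡-Reasoning

odd⇒≢4 : ∀ {n} → Odd n → n ≢ 4
odd⇒≢4 o refl = contradiction (odd⇒%2≡1 o) λ ()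

mainTheorem14 : Σ ((n : ℕ) → 3 ≤ n → Odd n → ReflexiveTournament) λ T →
    ((n : ℕ) (h : 3 ≤ n) (o : Odd n) → IsFinite (T n h o)) ×
    ((m n : ℕ) (hm : 3 ≤ m) (om : Odd m) (hn : 3 ≤ n) (on : Odd n) →
      m ≢ n → ¬ Siblings (T m hm om) (T n hn on))
mainTheorem14 =
  (λ n _ _ → PathTournament n) , (λ n _ _ → PathTournament-finite n) , notSiblings
  where
  notSiblings : (m n : ℕ) (hm : 3 ≤ m) (om : Odd m) (hn : 3 ≤ n) (on : Odd n) →
                m ≢ n → ¬ Siblings (PathTournament m) (PathTournament n)
  notSiblings m n hm om hn on m≢n siblings =
    m≢n (siblings⇒sameSize {PathTournament m} {PathTournament n}
      (PathTournament-prime (odd⇒≢4 om)) (PathTournament-noSink hm)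
      (PathTournament-prime (odd⇒≢4 on)) (PathTournament-noSink hn)
      (PathTournament-finite m) (PathTournament-finite n) siblings)
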